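{- If $S$ and $S'$ are continuously searchable $\mathfrak S$-types, then $S\times S'$ is continuously searchable.
   Context: $\mathfrak S$-types are defined inductively: every finite non-empty type is an $\mathfrak S$-type; if $S,S'$ are $\mathfrak S$-types then so is $S\times S'$; if $S$ is an $\mathfrak S$-type then so is $\mathbb N\to S$. The exactness type $E(S)$: $E(F)=\mathbf 1$ for finite $F$; $E(S\times S')=E(S)\times E(S')$; $E(\mathbb N\to S)=\mathbb N\times E(S)$. Equality with precision $p\in E(S)$, $x\equiv_p y$: for finite types iff $x=y$; for products componentwise, $(x_1,x_2)\equiv_{(p_1,p_2)}(y_1,y_2)$ iff $x_i\equiv_{p_i}y_i$; for sequences, $\alpha\equiv_{(m,p)}\beta$ iff $\alpha(i)\equiv_p\beta(i)$ for all $i<m$. A predicate $Q$ on $S$ is continuous if there is $q\in E(S)$ such that $x\equiv_q x'$ and $Q(x)$ imply $Q(x')$; it is detachable if it is decidable. A searcher on $S$ is a function $\mathscr E$ assigning to each detachable continuous predicate $Q$ on $S$ an element $\mathscr E(Q)\in S$ such that if some $x\in S$ satisfies $Q$ then $Q(\mathscr E(Q))$ holds. For predicates $P,Q$ on $S$ and $p\in E(S)$, $P\Leftrightarrow_p Q$ means that for all $x,x'$ with $x\equiv_p x'$, $P(x)$ holds iff $Q(x')$ holds. A searcher is continuous if $P\Leftrightarrow_p Q$ implies $\mathscr E(P)\equiv_p\mathscr E(Q)$ for all detachable continuous $P,Q$ and all $p$. An $\mathfrak S$-type is continuously searchable if it has a continuous searcher. -}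

module Defs where

open import Data.Nat using (ℕ; suc; _<_)
open import Data.Fin using (Fin)
open import Data.Unit using (⊤)
open import Data.Product using (Σ; _×_; _,_; ∃)
open import Relation.Binary.PropositionalEquality using (_≡_)
open import Relation.Nullary using (Dec)

-- Codes for 𝔖-types.  A finite non-empty type is represented (up to
-- bijection) by Fin (suc n).
data STy : Set where
  fin : ℕ → STy
  _⊗_ : STy → STy → STy
  seq : STy → STy

El : STy → Set
El (fin n) = Fin (suc n)
El (S ⊗ S') = El S × El S'
El (seq S) = ℕ → El S

Ex : STy → Set
Ex (fin n) = ⊤
Ex (S ⊗ S') = Ex S × Ex S'
Ex (seq S) = ℕ × Ex S

Eq : (S : STy) → Ex S → El S → El S → Set
Eq (fin n) _ x y = x ≡ y
Eq (S ⊗ S') (p₁ , p₂) (x₁ , x₂) (y₁ , y₂) = Eq S p₁ x₁ y₁ × Eq S' p₂ x₂ y₂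
Eq (seq S) (m , p) α β = ∀ i → i < m → Eq S p (α i) (β i)

Pred : STy → Set₁
Pred S = El S → Set

Detachable : (S : STy) → Pred S → Set
Detachable S Q = ∀ x → Dec (Q x)

Continuous : (S : STy) → Pred S → Set
Continuous S Q = Σ (Ex S) λ q → ∀ x x' → Eq S q x x' → Q x → Q x'

EquivAt : (S : STy) → Ex S → Pred S → Pred S → Set
EquivAt S p P Q = ∀ x x' → Eq S p x x' → (P x → Q x') × (Q x' → P x)

SearchFun : STy → Set₁
SearchFun S = (Q : Pred S) → Detachable S Q → Continuous S Q → El S

IsSearcher : (S : STy) → SearchFun S → Set₁
IsSearcher S 𝓔 = ∀ (Q : Pred S) (d : Detachable S Q) (c : Continuous S Q) →
  ∃ Q → Q (𝓔 Q d c)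

IsContinuousSearcher : (S : STy) → SearchFun S → Set₁
IsContinuousSearcher S 𝓔 =
  ∀ (P Q : Pred S) (dP : Detachable S P) (cP : Continuous S P)
    (dQ : Detachable S Q) (cQ : Continuous S Q) (p : Ex S) →
  EquivAt S p P Q → Eq S p (𝓔 P dP cP) (𝓔 Q dQ cQ)

ContinuouslySearchable : STy → Set₁
ContinuouslySearchable S =
  Σ (SearchFun S) λ 𝓔 → IsSearcher S 𝓔 × IsContinuousSearcher S 𝓔

-- The product searcher first searches S for an x whose section λ y → Q (x , y)
-- is solved by the searcher of S', then completes x by that solution.  Since
-- both searchers are continuous, the second search depends continuously on x,
-- which makes the first search predicate continuous and the composite
-- searcher continuous.
module Submission where

open import Defs
open import Data.Product using (_,_; proj₁; proj₂)
open import Relation.Binary.PropositionalEquality using (refl; sym)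

Eq-refl : (S : STy) (p : Ex S) (x : El S) → Eq S p x x
Eq-refl (fin n) p x = refl
Eq-refl (S ⊗ S') (p , p') (x , x') = Eq-refl S p x , Eq-refl S' p' x'
Eq-refl (seq S) (m , p) α i _ = Eq-refl S p (α i)

Eq-sym : (S : STy) (p : Ex S) {x y : El S} → Eq S p x y → Eq S p y x
Eq-sym (fin n) p e = sym e
Eq-sym (S ⊗ S') (p , p') (e , e') = Eq-sym S p e , Eq-sym S' p' e'
Eq-sym (seq S) (m , p) e i i<m = Eq-sym S p (e i i<m)

Continuous⇒EquivAt-modulus : {S : STy} {Q : Pred S} (c : Continuous S Q) →
  EquivAt S (proj₁ c) Q Q
Continuous⇒EquivAt-modulus {S} (q , f) x x' e = f x x' e , f x' x (Eq-sym S q e)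

module _ {S S' : STy} where

  section : Pred (S ⊗ S') → El S → Pred S'
  section Q x y = Q (x , y)

  section-detachable : {Q : Pred (S ⊗ S')} → Detachable (S ⊗ S') Q →
    ∀ x → Detachable S' (section Q x)
  section-detachable d x y = d (x , y)

  section-continuous : {Q : Pred (S ⊗ S')} → Continuous (S ⊗ S') Q →
    ∀ x → Continuous S' (section Q x)
  section-continuous ((q , q') , f) x =
    q' , λ y y' e → f (x , y) (x , y') (Eq-refl S q x , e)

  section-equivAt : ∀ {P Q p p' x x'} → EquivAt (S ⊗ S') (p , p') P Q →
    Eq S p x x' → EquivAt S' p' (section P x) (section Q x')
  section-equivAt P⇔Q ex y y' ey = P⇔Q (_ , y) (_ , y') (ex , ey)

module ProductSearch {S S' : STy} (𝓔 : SearchFun S) (𝓔' : SearchFun S')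
                     (𝓔'-continuous : IsContinuousSearcher S' 𝓔') where

  sectionSearch : (Q : Pred (S ⊗ S')) → Detachable (S ⊗ S') Q →
    Continuous (S ⊗ S') Q → El S → El S'
  sectionSearch Q d c x =
    𝓔' (section Q x) (section-detachable d x) (section-continuous c x)

  sectionSearch-cong : ∀ {P Q} dP cP dQ cQ {p p' x x'} →
    EquivAt (S ⊗ S') (p , p') P Q → Eq S p x x' →
    Eq S' p' (sectionSearch P dP cP x) (sectionSearch Q dQ cQ x')
  sectionSearch-cong dP cP dQ cQ P⇔Q ex =
    𝓔'-continuous _ _
      (section-detachable dP _) (section-continuous cP _)
      (section-detachable dQ _) (section-continuous cQ _)
      _ (section-equivAt P⇔Q ex)

  solvedAt : (Q : Pred (S ⊗ S')) → Detachable (S ⊗ S') Q →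
    Continuous (S ⊗ S') Q → Pred S
  solvedAt Q d c x = Q (x , sectionSearch Q d c x)

  solvedAt-detachable : ∀ {Q} d c → Detachable S (solvedAt Q d c)
  solvedAt-detachable d c x = d (x , sectionSearch _ d c x)

  solvedAt-equivAt : ∀ {P Q} dP cP dQ cQ {p p'} →
    EquivAt (S ⊗ S') (p , p') P Q →
    EquivAt S p (solvedAt P dP cP) (solvedAt Q dQ cQ)
  solvedAt-equivAt dP cP dQ cQ P⇔Q x x' ex =
    P⇔Q _ _ (ex , sectionSearch-cong dP cP dQ cQ P⇔Q ex)

  solvedAt-continuous : ∀ {Q} d c → Continuous S (solvedAt Q d c)
  solvedAt-continuous d c =
    proj₁ (proj₁ c) , λ x x' e →
      proj₁ (solvedAt-equivAt d c d c (Continuous⇒EquivAt-modulus c) x x' e)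

  search : SearchFun (S ⊗ S')
  search Q d c = x , sectionSearch Q d c x
    where
    x : El S
    x = 𝓔 (solvedAt Q d c) (solvedAt-detachable d c) (solvedAt-continuous d c)

  search-isSearcher : IsSearcher S 𝓔 → IsSearcher S' 𝓔' → IsSearcher (S ⊗ S') search
  search-isSearcher 𝓔-searcher 𝓔'-searcher Q d c ((x , y) , Qxy) =
    𝓔-searcher _ (solvedAt-detachable d c) (solvedAt-continuous d c)
      (x , 𝓔'-searcher _ (section-detachable d x) (section-continuous c x) (y , Qxy))

  search-isContinuous : IsContinuousSearcher S 𝓔 → IsContinuousSearcher (S ⊗ S') search
  search-isContinuous 𝓔-continuous P Q dP cP dQ cQ (p , _) P⇔Q =
    ex , sectionSearch-cong dP cP dQ cQ P⇔Q ex
    where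
    ex : Eq S p (proj₁ (search P dP cP)) (proj₁ (search Q dQ cQ))
    ex = 𝓔-continuous _ _
           (solvedAt-detachable dP cP) (solvedAt-continuous dP cP)
           (solvedAt-detachable dQ cQ) (solvedAt-continuous dQ cQ)
           p (solvedAt-equivAt dP cP dQ cQ P⇔Q)

mainTheorem5 : (S S' : STy) → ContinuouslySearchable S → ContinuouslySearchable S' →
    ContinuouslySearchable (S ⊗ S')
mainTheorem5 S S' (𝓔 , 𝓔-searcher , 𝓔-continuous) (𝓔' , 𝓔'-searcher , 𝓔'-continuous) =
  search , search-isSearcher 𝓔-searcher 𝓔'-searcher , search-isContinuous 𝓔-continuous
  where open ProductSearch 𝓔 𝓔' 𝓔'-continuous
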